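{- Let $n\geq 4$ and, for $1\leq i\leq n$ and $j\in\{0,1,2\}$, let $d_{i,j}$ be the number of permutations $p=p_1\cdots p_n$ of $\{1,\dots,n\}$ such that the node $p_i$ has exactly $j$ children in the minmax tree $T^m_p$. Then $d_{i,j}=n!/3$ for all $2\leq i\leq n-2$ and all $j\in\{0,1,2\}$.
   Context: For a word $w$ of distinct integers, its minmax tree $T^m_w$ is the binary tree defined recursively: if $w$ is empty the tree is empty; otherwise write $w=u\,m\,v$ where $m$ is the leftmost of the two letters of $w$ that are its minimum and its maximum (i.e. whichever of $\min w$, $\max w$ occurs first), $u$ is the subword before $m$ and $v$ the subword after $m$. Then $T^m_w$ has root $m$, left subtree $T^m_u$ and right subtree $T^m_v$. For a permutation $p$ of length $n$, the nodes of $T^m_p$ are the entries $p_1,\dots,p_n$; the number of children of $p_i$ is the number of nonempty subtrees (left and right) attached to $p_i$. -}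

module Defs where

open import Data.Nat using (ℕ; zero; suc; _⊓_; _⊔_; _+_)
open import Relation.Nullary using (yes; no)
open import Data.Nat.Properties using (_≟_)
open import Data.List using (List; []; _∷_; map; concatMap; upTo; filter; length; foldr)
open import Data.List.Relation.Unary.Unique.Propositional using (Unique)
open import Data.List.Relation.Unary.Unique.DecPropositional _≟_ using (unique?)
open import Data.Product using (_×_; _,_)
open import Data.Bool using (Bool; true; false; _∨_)
open import Relation.Nullary.Decidable using (⌊_⌋)

data Tree : Set where
  leaf : Tree
  node : Tree → ℕ → Tree → Tree

-- split w at the leftmost letter equal to mn or mx:  w = u m v.
-- (Only used with mn = min w, mx = max w, so the letter always exists.)
splitMM : ℕ → ℕ → List ℕ → List ℕ × ℕ × List ℕ
splitMM mn mx [] = [] , 0 , []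
splitMM mn mx (x ∷ xs) with ⌊ x ≟ mn ⌋ ∨ ⌊ x ≟ mx ⌋
... | true  = [] , x , xs
... | false with splitMM mn mx xs
...   | u , m , v = x ∷ u , m , v

-- minmax tree, with fuel (fuel = length of the word suffices)
minmaxTreeF : ℕ → List ℕ → Tree
minmaxTreeF zero    _        = leaf
minmaxTreeF (suc k) []       = leaf
minmaxTreeF (suc k) (x ∷ xs) with splitMM (foldr _⊓_ x xs) (foldr _⊔_ x xs) (x ∷ xs)
... | u , m , v = node (minmaxTreeF k u) m (minmaxTreeF k v)

minmaxTree : List ℕ → Tree
minmaxTree w = minmaxTreeF (length w) w

nonempty : Tree → ℕ
nonempty leaf = 0
nonempty (node _ _ _) = 1

-- number of children of the (unique, labels distinct) node labelled a (0 if absent)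
childrenOf : ℕ → Tree → ℕ
childrenOf a leaf = 0
childrenOf a (node l m r) with a ≟ m
... | yes _ = nonempty l + nonempty r
... | no  _ = childrenOf a l + childrenOf a r

-- 1-based position: p_i (0 if out of range)
at : List ℕ → ℕ → ℕ
at []       _             = 0
at (x ∷ xs) zero          = 0
at (x ∷ xs) (suc zero)    = x
at (x ∷ xs) (suc (suc i)) = at xs (suc i)

words : ℕ → ℕ → List (List ℕ)
words n zero    = [] ∷ []
words n (suc k) = concatMap (λ x → map (x ∷_) (words n k)) (map suc (upTo n))

perms : ℕ → List (List ℕ)
perms n = filter unique? (words n n)

children : List ℕ → ℕ → ℕ
children p i = childrenOf (at p i) (minmaxTree p)

d : ℕ → ℕ → ℕ → ℕ
d n i j = length (filter (λ p → children p i ≟ j) (perms n))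

-- Prepending a letter x to a word w changes the minmax tree only along its leftmost branch: either x
-- is a new extreme and becomes the root with T(w) as its only subtree, or x is inserted into the part
-- of w before the root. So every letter after the first keeps its number of children, which reduces
-- position i of a permutation of {1,…,n} to position 2 of arrangements of n − i + 2 ≥ 4 letters.
-- There either p₁ has one child and p₂ keeps the number c ≤ 1 of children it has in T(p₂⋯pₙ) (a first
-- letter has no left subtree), or p₁ is a leaf below p₂, which then has two children and had one.
-- Hence p₂ has two children iff p₁ is a leaf of T(p), and none iff p₂ is a leaf of T(p₂⋯pₙ).
--
-- It remains to count the arrangements ℓ(n) of n letters whose first letter is a leaf. Classify them
-- by their last letter z: a z strictly between the other letters leaves the first letter unaffected,
-- while for z the maximum (minimum) the first letter has the children that the first letter of the
-- prefix before the minimum (maximum) has in the tree of that prefix, or one child if the prefix is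
-- empty. With g(n) the number of arrangements whose first letter becomes a leaf when a new maximum
-- (or, symmetrically, a new minimum) is appended, the same classification gives
-- ℓ(n+2) = 2 g(n+1) + n ℓ(n+1) and g(n+2) = ℓ(n+1) + (n+1) g(n+1) with ℓ(1) = 1 and g(1) = 0,
-- so that ℓ(n) = g(n) = n!/3 for n ≥ 3.

module Submission where

open import Defs
open import Data.Nat using (ℕ; _≤_; _<_; _∸_; _!; zero; suc; _+_; _*_; s≤s; z≤n; _⊓_; _⊔_)
open import Data.Nat.Properties
open import Data.Nat.DivMod using (_/_; m*n/n≡m)
open import Data.Nat.Induction using (<-wellFounded)
open import Induction.WellFounded using (Acc; acc)
open import Algebra.Properties.CommutativeSemigroup +-commutativeSemigroup using (interchange)
open import Algebra.Properties.CommutativeSemigroup *-commutativeSemigroup using (x∙yz≈y∙xz)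
open import Data.List using (List; []; _∷_; [_]; _++_; _∷ʳ_; map; concatMap; length; filter; foldr; drop; upTo)
open import Data.List.Properties using (filter-all; filter-accept; filter-reject; ++-assoc; length-map; length-upTo)
open import Data.List.Membership.Propositional using (_∈_; _∉_; find)
open import Data.List.Membership.Propositional.Properties
  using (∈-filter⁺; ∈-filter⁻; ∈-concatMap⁻; ∈-map⁻; foldr-selective; ∈-++⁺ˡ; ∈-++⁺ʳ; ∈-++⁻)
open import Data.List.Relation.Binary.Subset.Propositional using (_⊆_)
open import Data.List.Relation.Unary.Any using (here; there)
open import Data.List.Relation.Unary.All as All using (All; []; _∷_; all?)
open import Data.List.Relation.Unary.All.Properties using (++⁻ˡ; ¬Any⇒All¬)
open import Data.List.Relation.Unary.AllPairs using ([]; _∷_)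
open import Data.List.Relation.Unary.Unique.Propositional using (Unique)
open import Data.List.Relation.Unary.Unique.Propositional.Properties as Unique
  using (Unique[x∷xs]⇒x∉xs; map⁺; upTo⁺)
open import Data.List.Relation.Unary.Unique.DecPropositional _≟_ using (unique?)
open import Data.Product using (_×_; _,_; proj₁; proj₂; ∃-syntax; swap)
open import Data.Sum using (_⊎_; inj₁; inj₂; [_,_]′; reduce) renaming (swap to swap⊎)
open import Data.Bool using (if_then_else_)
open import Data.Empty using (⊥-elim)
open import Function using (_∘_; _⇔_; mk⇔; Equivalence)
open import Relation.Nullary using (Dec; yes; no; does)
open import Relation.Nullary.Decidable using (¬?; _×-dec_; dec-true; dec-false)
open import Relation.Binary.Definitions using (tri<; tri≈; tri>)
open import Relation.Binary.PropositionalEquality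
  using (_≡_; _≢_; refl; sym; trans; cong; cong₂; subst; subst₂; module ≡-Reasoning)

private variable A B : Set

-- Sums over lists

∑ : List A → (A → ℕ) → ℕ
∑ []       f = 0
∑ (x ∷ xs) f = f x + ∑ xs f

syntax ∑ xs (λ x → e) = ∑[ x ∈ xs ] e

∑-++ : ∀ xs ys (f : A → ℕ) → ∑ (xs ++ ys) f ≡ ∑ xs f + ∑ ys f
∑-++ []       ys f = refl
∑-++ (x ∷ xs) ys f = trans (cong (f x +_) (∑-++ xs ys f)) (sym (+-assoc (f x) _ _))

∑-map : ∀ (g : A → B) xs (f : B → ℕ) → ∑ (map g xs) f ≡ ∑[ x ∈ xs ] f (g x)
∑-map g []       f = refl
∑-map g (x ∷ xs) f = cong (f (g x) +_) (∑-map g xs f)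

∑-concatMap : ∀ (g : A → List B) xs (f : B → ℕ) → ∑ (concatMap g xs) f ≡ ∑[ x ∈ xs ] ∑ (g x) f
∑-concatMap g []       f = refl
∑-concatMap g (x ∷ xs) f = trans (∑-++ (g x) _ f) (cong (∑ (g x) f +_) (∑-concatMap g xs f))

∑-cong : ∀ xs {f g : A → ℕ} → (∀ {x} → x ∈ xs → f x ≡ g x) → ∑ xs f ≡ ∑ xs g
∑-cong []       eq = refl
∑-cong (x ∷ xs) eq = cong₂ _+_ (eq (here refl)) (∑-cong xs (eq ∘ there))

∑-prepend : ∀ (xs : List A) (F : A → List (List A)) (f : List A → ℕ) →
  ∑ (concatMap (λ x → map (x ∷_) (F x)) xs) f ≡ ∑[ x ∈ xs ] ∑[ w ∈ F x ] f (x ∷ w)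
∑-prepend xs F f = trans (∑-concatMap _ xs f) (∑-cong xs (λ {x} _ → ∑-map (x ∷_) (F x) f))

∑-+ : ∀ xs (f g : A → ℕ) → ∑[ x ∈ xs ] (f x + g x) ≡ ∑ xs f + ∑ xs g
∑-+ []       f g = refl
∑-+ (x ∷ xs) f g = trans (cong (f x + g x +_) (∑-+ xs f g)) (interchange (f x) (g x) _ _)

∑-*ˡ : ∀ c xs (f : A → ℕ) → ∑[ x ∈ xs ] (c * f x) ≡ c * ∑ xs f
∑-*ˡ c []       f = sym (*-zeroʳ c)
∑-*ˡ c (x ∷ xs) f = trans (cong (c * f x +_) (∑-*ˡ c xs f)) (sym (*-distribˡ-+ c (f x) _))

∑-const : ∀ (xs : List A) c → ∑[ x ∈ xs ] c ≡ length xs * c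
∑-const []       c = refl
∑-const (x ∷ xs) c = cong (c +_) (∑-const xs c)

∑-constOn : ∀ xs {f : A → ℕ} {c} → (∀ {x} → x ∈ xs → f x ≡ c) → ∑ xs f ≡ length xs * c
∑-constOn xs eq = trans (∑-cong xs eq) (∑-const xs _)

∑-1 : ∀ (xs : List A) → ∑[ x ∈ xs ] 1 ≡ length xs
∑-1 xs = trans (∑-const xs 1) (*-identityʳ _)

∑-swap : ∀ xs ys (f : A → B → ℕ) →
  ∑[ x ∈ xs ] ∑[ y ∈ ys ] f x y ≡ ∑[ y ∈ ys ] ∑[ x ∈ xs ] f x y
∑-swap []       ys f = sym (trans (∑-const ys 0) (*-zeroʳ (length ys)))
∑-swap (x ∷ xs) ys f = trans (cong (∑ ys (f x) +_) (∑-swap xs ys f)) (sym (∑-+ ys (f x) _))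

𝟙 : {P : Set} → Dec P → ℕ
𝟙 P? = if does P? then 1 else 0

𝟙-⇔ : {P Q : Set} (P? : Dec P) (Q? : Dec Q) → P ⇔ Q → 𝟙 P? ≡ 𝟙 Q?
𝟙-⇔ (yes _) (yes _) _   = refl
𝟙-⇔ (yes p) (no ¬q) P⇔Q = ⊥-elim (¬q (Equivalence.to P⇔Q p))
𝟙-⇔ (no ¬p) (yes q) P⇔Q = ⊥-elim (¬p (Equivalence.from P⇔Q q))
𝟙-⇔ (no _)  (no _)  _   = refl

𝟙-× : {P Q : Set} (P? : Dec P) (Q? : Dec Q) → 𝟙 (P? ×-dec Q?) ≡ 𝟙 P? * 𝟙 Q?
𝟙-× (yes _) (yes _) = refl
𝟙-× (yes _) (no _)  = refl
𝟙-× (no _)  _       = refl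

𝟙-yes : {a b : ℕ} → a ≡ b → 𝟙 (a ≟ b) ≡ 1
𝟙-yes {a} {b} a≡b = cong (λ b → if b then 1 else 0) (dec-true (a ≟ b) a≡b)

𝟙-no : {a b : ℕ} → a ≢ b → 𝟙 (a ≟ b) ≡ 0
𝟙-no {a} {b} a≢b = cong (λ b → if b then 1 else 0) (dec-false (a ≟ b) a≢b)

𝟙-partition : ∀ c → c ≤ 2 → 𝟙 (c ≟ 0) + 𝟙 (c ≟ 1) + 𝟙 (c ≟ 2) ≡ 1
𝟙-partition 0 _ = refl
𝟙-partition 1 _ = refl
𝟙-partition 2 _ = refl
𝟙-partition (suc (suc (suc _))) (s≤s (s≤s ()))

∑-filter : ∀ {P : A → Set} (P? : ∀ x → Dec (P x)) xs (f : A → ℕ) →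
  ∑ (filter P? xs) f ≡ ∑[ x ∈ xs ] (𝟙 (P? x) * f x)
∑-filter P? []       f = refl
∑-filter P? (x ∷ xs) f with P? x
... | yes _ = cong₂ _+_ (sym (*-identityˡ (f x))) (∑-filter P? xs f)
... | no _  = ∑-filter P? xs f

length-filter : ∀ {P : A → Set} (P? : ∀ x → Dec (P x)) xs →
  length (filter P? xs) ≡ ∑[ x ∈ xs ] 𝟙 (P? x)
length-filter P? xs = begin
  length (filter P? xs)                   ≡⟨ sym (∑-1 (filter P? xs)) ⟩
  ∑[ x ∈ filter P? xs ] 1                 ≡⟨ ∑-filter P? xs (λ _ → 1) ⟩
  ∑[ x ∈ xs ] (𝟙 (P? x) * 1)              ≡⟨ ∑-cong xs (λ {x} _ → *-identityʳ (𝟙 (P? x))) ⟩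
  ∑[ x ∈ xs ] 𝟙 (P? x)                    ∎
  where open ≡-Reasoning

-- Arrangements

infixl 6 _∖_

_∖_ : List ℕ → ℕ → List ℕ
S ∖ x = filter (λ y → ¬? (x ≟ y)) S

∈-∖⁺ : ∀ {x y} S → y ∈ S → x ≢ y → y ∈ S ∖ x
∈-∖⁺ S = ∈-filter⁺ _

∈-∖⁻ : ∀ {x y} S → y ∈ S ∖ x → y ∈ S × x ≢ y
∈-∖⁻ S = ∈-filter⁻ _

∉-∖ : ∀ x S → x ∉ S ∖ x
∉-∖ x S x∈ = proj₂ (∈-∖⁻ S x∈) refl

∖-unique : ∀ x {S} → Unique S → Unique (S ∖ x)
∖-unique x = Unique.filter⁺ _

∖-∉ : ∀ {x} S → x ∉ S → S ∖ x ≡ S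
∖-∉ {x} S x∉S = filter-all (λ y → ¬? (x ≟ y)) (¬Any⇒All¬ S x∉S)

∷-∖-≡ : ∀ x S → (x ∷ S) ∖ x ≡ S ∖ x
∷-∖-≡ x S = filter-reject (λ y → ¬? (x ≟ y)) {xs = S} (λ x≢x → x≢x refl)

∷-∖-≢ : ∀ {x y} S → x ≢ y → (y ∷ S) ∖ x ≡ y ∷ S ∖ x
∷-∖-≢ {x} S = filter-accept (λ y → ¬? (x ≟ y)) {xs = S}

∑-∖ : ∀ {x} S (f : ℕ → ℕ) → Unique S → x ∈ S → ∑ S f ≡ f x + ∑ (S ∖ x) f
∑-∖ {x} (.x ∷ S) f u (here refl) =
  cong (λ T → f x + ∑ T f) (sym (trans (∷-∖-≡ x S) (∖-∉ S (Unique[x∷xs]⇒x∉xs u))))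
∑-∖ {x} (y ∷ S) f (y≢S ∷ u) (there x∈) = begin
  f y + ∑ S f                ≡⟨ cong (f y +_) (∑-∖ S f u x∈) ⟩
  f y + (f x + ∑ (S ∖ x) f)  ≡⟨ sym (+-assoc (f y) _ _) ⟩
  f y + f x + ∑ (S ∖ x) f    ≡⟨ cong (_+ ∑ (S ∖ x) f) (+-comm (f y) (f x)) ⟩
  f x + f y + ∑ (S ∖ x) f    ≡⟨ +-assoc (f x) _ _ ⟩
  f x + (f y + ∑ (S ∖ x) f)  ≡⟨ cong (λ T → f x + ∑ T f) (sym (∷-∖-≢ S x≢y)) ⟩
  f x + ∑ ((y ∷ S) ∖ x) f    ∎
  where
  open ≡-Reasoning
  x≢y : x ≢ y
  x≢y refl = Unique[x∷xs]⇒x∉xs (y≢S ∷ u) x∈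

length-∖ : ∀ {x n} S → Unique S → x ∈ S → length S ≡ suc n → length (S ∖ x) ≡ n
length-∖ {x} S u x∈ ∣S∣ = suc-injective (begin
  suc (length (S ∖ x))       ≡⟨ cong suc (sym (∑-1 (S ∖ x))) ⟩
  suc (∑[ y ∈ S ∖ x ] 1)     ≡⟨ sym (∑-∖ S (λ _ → 1) u x∈) ⟩
  ∑[ y ∈ S ] 1               ≡⟨ ∑-1 S ⟩
  length S                   ≡⟨ ∣S∣ ⟩
  suc _                      ∎)
  where open ≡-Reasoning

∖-comm : ∀ x z S → S ∖ x ∖ z ≡ S ∖ z ∖ x
∖-comm x z []      = refl
∖-comm x z (y ∷ S) with x ≟ y | z ≟ y
... | yes refl | yes refl = refl
... | yes refl | no z≢x  = begin
  (x ∷ S) ∖ x ∖ z  ≡⟨ cong (_∖ z) (∷-∖-≡ x S) ⟩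
  S ∖ x ∖ z        ≡⟨ ∖-comm x z S ⟩
  S ∖ z ∖ x        ≡⟨ sym (∷-∖-≡ x (S ∖ z)) ⟩
  (x ∷ S ∖ z) ∖ x  ≡⟨ cong (_∖ x) (sym (∷-∖-≢ S z≢x)) ⟩
  (x ∷ S) ∖ z ∖ x  ∎
  where open ≡-Reasoning
... | no x≢z  | yes refl = begin
  (z ∷ S) ∖ x ∖ z  ≡⟨ cong (_∖ z) (∷-∖-≢ S x≢z) ⟩
  (z ∷ S ∖ x) ∖ z  ≡⟨ ∷-∖-≡ z (S ∖ x) ⟩
  S ∖ x ∖ z        ≡⟨ ∖-comm x z S ⟩
  S ∖ z ∖ x        ≡⟨ cong (_∖ x) (sym (∷-∖-≡ z S)) ⟩
  (z ∷ S) ∖ z ∖ x  ∎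
  where open ≡-Reasoning
... | no x≢y  | no z≢y  = begin
  (y ∷ S) ∖ x ∖ z  ≡⟨ cong (_∖ z) (∷-∖-≢ S x≢y) ⟩
  (y ∷ S ∖ x) ∖ z  ≡⟨ ∷-∖-≢ (S ∖ x) z≢y ⟩
  y ∷ S ∖ x ∖ z    ≡⟨ cong (y ∷_) (∖-comm x z S) ⟩
  y ∷ S ∖ z ∖ x    ≡⟨ sym (∷-∖-≢ (S ∖ z) x≢y) ⟩
  (y ∷ S ∖ z) ∖ x  ≡⟨ cong (_∖ x) (sym (∷-∖-≢ S z≢y)) ⟩
  (y ∷ S) ∖ z ∖ x  ∎
  where open ≡-Reasoning

arrangements : List ℕ → ℕ → List (List ℕ)
arrangements S zero    = [ [] ]
arrangements S (suc k) = concatMap (λ x → map (x ∷_) (arrangements (S ∖ x) k)) S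

∑-arrangements-∷ : ∀ S k (f : List ℕ → ℕ) →
  ∑ (arrangements S (suc k)) f ≡ ∑[ x ∈ S ] ∑[ w ∈ arrangements (S ∖ x) k ] f (x ∷ w)
∑-arrangements-∷ S k = ∑-prepend S (λ x → arrangements (S ∖ x) k)

∑-arrangements-∷ʳ : ∀ S k (f : List ℕ → ℕ) →
  ∑ (arrangements S (suc k)) f ≡ ∑[ z ∈ S ] ∑[ w ∈ arrangements (S ∖ z) k ] f (w ∷ʳ z)
∑-arrangements-∷ʳ S zero    f = ∑-arrangements-∷ S zero f
∑-arrangements-∷ʳ S (suc k) f = begin
  ∑ (arrangements S (2 + k)) f
    ≡⟨ ∑-arrangements-∷ S (suc k) f ⟩
  ∑[ x ∈ S ] ∑[ w ∈ arrangements (S ∖ x) (suc k) ] f (x ∷ w)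
    ≡⟨ ∑-cong S (λ {x} _ → ∑-arrangements-∷ʳ (S ∖ x) k (λ w → f (x ∷ w))) ⟩
  ∑[ x ∈ S ] ∑[ z ∈ S ∖ x ] F x z
    ≡⟨ ∑-cong S (λ {x} _ → ∑-filter (λ z → ¬? (x ≟ z)) S (F x)) ⟩
  ∑[ x ∈ S ] ∑[ z ∈ S ] (𝟙 (¬? (x ≟ z)) * F x z)
    ≡⟨ ∑-swap S S _ ⟩
  ∑[ z ∈ S ] ∑[ x ∈ S ] (𝟙 (¬? (x ≟ z)) * F x z)
    ≡⟨ ∑-cong S (λ {z} _ → ∑-cong S (λ {x} _ →
         cong₂ _*_ (𝟙-⇔ (¬? (x ≟ z)) (¬? (z ≟ x)) (mk⇔ (_∘ sym) (_∘ sym)))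
                   (cong (λ T → ∑[ w ∈ arrangements T k ] f (x ∷ w ∷ʳ z)) (∖-comm x z S)))) ⟩
  ∑[ z ∈ S ] ∑[ x ∈ S ] (𝟙 (¬? (z ≟ x)) * ∑[ w ∈ arrangements (S ∖ z ∖ x) k ] f (x ∷ w ∷ʳ z))
    ≡⟨ ∑-cong S (λ {z} _ → sym (∑-filter (λ x → ¬? (z ≟ x)) S _)) ⟩
  ∑[ z ∈ S ] ∑[ x ∈ S ∖ z ] ∑[ w ∈ arrangements (S ∖ z ∖ x) k ] f (x ∷ w ∷ʳ z)
    ≡⟨ ∑-cong S (λ {z} _ → sym (∑-arrangements-∷ (S ∖ z) k (λ w → f (w ∷ʳ z)))) ⟩
  ∑[ z ∈ S ] ∑[ w ∈ arrangements (S ∖ z) (suc k) ] f (w ∷ʳ z)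
    ∎
  where
  open ≡-Reasoning
  F : ℕ → ℕ → ℕ
  F x z = ∑[ w ∈ arrangements (S ∖ x ∖ z) k ] f (x ∷ w ∷ʳ z)

∈-arrangements-suc⁻ : ∀ S k {w} → w ∈ arrangements S (suc k) →
  ∃[ x ] ∃[ v ] x ∈ S × v ∈ arrangements (S ∖ x) k × w ≡ x ∷ v
∈-arrangements-suc⁻ S k w∈
  with find (∈-concatMap⁻ (λ x → map (x ∷_) (arrangements (S ∖ x) k)) {xs = S} w∈)
... | x , x∈S , w∈x∷ with ∈-map⁻ (x ∷_) w∈x∷
...   | v , v∈ , w≡x∷v = x , v , x∈S , v∈ , w≡x∷v

arrangement-⊆ : ∀ S k {w} → w ∈ arrangements S k → w ⊆ S
arrangement-⊆ S zero    (here refl) ()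
arrangement-⊆ S (suc k) w∈ with ∈-arrangements-suc⁻ S k w∈
... | x , v , x∈S , v∈ , refl = λ
  { (here refl) → x∈S
  ; (there y∈v) → proj₁ (∈-∖⁻ S (arrangement-⊆ (S ∖ x) k v∈ y∈v))
  }

arrangement-∉ : ∀ S x k {w} → w ∈ arrangements (S ∖ x) k → x ∉ w
arrangement-∉ S x k w∈ x∈w = ∉-∖ x S (arrangement-⊆ (S ∖ x) k w∈ x∈w)

arrangement-unique-∷ : ∀ S x k {w} → w ∈ arrangements (S ∖ x) k → Unique (x ∷ w)

arrangement-unique : ∀ S k {w} → w ∈ arrangements S k → Unique w
arrangement-unique S zero    (here refl) = []
arrangement-unique S (suc k) w∈ with ∈-arrangements-suc⁻ S k w∈
... | x , v , _ , v∈ , refl = arrangement-unique-∷ S x k v∈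
arrangement-unique-∷ S x k w∈ = ¬Any⇒All¬ _ (arrangement-∉ S x k w∈) ∷ arrangement-unique (S ∖ x) k w∈

arrangement-length : ∀ S k {w} → w ∈ arrangements S k → length w ≡ k
arrangement-length S zero    (here refl) = refl
arrangement-length S (suc k) w∈ with ∈-arrangements-suc⁻ S k w∈
... | x , v , _ , v∈ , refl = cong suc (arrangement-length (S ∖ x) k v∈)

arrangement-⊇ : ∀ S k {w} → Unique S → length S ≡ k → w ∈ arrangements S k → S ⊆ w
arrangement-⊇ []  zero    _ _ _ ()
arrangement-⊇ S   (suc k) u ∣S∣≡ w∈ {y} y∈S with ∈-arrangements-suc⁻ S k w∈
... | x , v , x∈S , v∈ , refl with x ≟ y
...   | yes refl = here refl
...   | no x≢y   =
  there (arrangement-⊇ (S ∖ x) k (∖-unique x u) (length-∖ S u x∈S ∣S∣≡) v∈ (∈-∖⁺ S y∈S x≢y))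

∑-arrangements-1 : ∀ S n → Unique S → length S ≡ n → ∑[ w ∈ arrangements S n ] 1 ≡ n !
∑-arrangements-1 [] zero u ∣S∣≡ = refl
∑-arrangements-1 S (suc n) u ∣S∣≡ = begin
  ∑[ w ∈ arrangements S (suc n) ] 1
    ≡⟨ ∑-arrangements-∷ S n _ ⟩
  ∑[ x ∈ S ] ∑[ w ∈ arrangements (S ∖ x) n ] 1
    ≡⟨ ∑-constOn S (λ {x} x∈S → ∑-arrangements-1 (S ∖ x) n (∖-unique x u) (length-∖ S u x∈S ∣S∣≡)) ⟩
  length S * n !
    ≡⟨ cong (_* n !) ∣S∣≡ ⟩
  suc n * n !
    ∎
  where open ≡-Reasoning

-- The number d as a sum over arrangements

wordsOver : List ℕ → ℕ → List (List ℕ)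
wordsOver A zero    = [ [] ]
wordsOver A (suc k) = concatMap (λ x → map (x ∷_) (wordsOver A k)) A

words≡wordsOver : ∀ n k → words n k ≡ wordsOver (map suc (upTo n)) k
words≡wordsOver n zero    = refl
words≡wordsOver n (suc k) =
  cong (λ W → concatMap (λ x → map (x ∷_) W) (map suc (upTo n))) (words≡wordsOver n k)

∑-wordsOver-filter : ∀ {P : ℕ → Set} (P? : ∀ x → Dec (P x)) A k (h : List ℕ → ℕ) →
  ∑[ w ∈ wordsOver A k ] (𝟙 (all? P? w) * h w) ≡ ∑ (wordsOver (filter P? A) k) h
∑-wordsOver-filter P? A zero    h = cong (_+ 0) (*-identityˡ (h []))
∑-wordsOver-filter P? A (suc k) h = begin
  ∑[ w ∈ wordsOver A (suc k) ] (𝟙 (all? P? w) * h w)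
    ≡⟨ ∑-prepend A (λ _ → wordsOver A k) _ ⟩
  ∑[ x ∈ A ] ∑[ w ∈ wordsOver A k ] (𝟙 (all? P? (x ∷ w)) * h (x ∷ w))
    ≡⟨ ∑-cong A (λ {x} _ → ∑-cong (wordsOver A k) (λ {w} _ → split x w)) ⟩
  ∑[ x ∈ A ] ∑[ w ∈ wordsOver A k ] (𝟙 (P? x) * (𝟙 (all? P? w) * h (x ∷ w)))
    ≡⟨ ∑-cong A (λ {x} _ → ∑-*ˡ (𝟙 (P? x)) (wordsOver A k) _) ⟩
  ∑[ x ∈ A ] (𝟙 (P? x) * ∑[ w ∈ wordsOver A k ] (𝟙 (all? P? w) * h (x ∷ w)))
    ≡⟨ ∑-cong A (λ {x} _ → cong (𝟙 (P? x) *_) (∑-wordsOver-filter P? A k (λ w → h (x ∷ w)))) ⟩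
  ∑[ x ∈ A ] (𝟙 (P? x) * ∑[ w ∈ wordsOver (filter P? A) k ] h (x ∷ w))
    ≡⟨ sym (∑-filter P? A _) ⟩
  ∑[ x ∈ filter P? A ] ∑[ w ∈ wordsOver (filter P? A) k ] h (x ∷ w)
    ≡⟨ sym (∑-prepend (filter P? A) (λ _ → wordsOver (filter P? A) k) h) ⟩
  ∑ (wordsOver (filter P? A) (suc k)) h
    ∎
  where
  open ≡-Reasoning
  split : ∀ x w → 𝟙 (all? P? (x ∷ w)) * h (x ∷ w) ≡ 𝟙 (P? x) * (𝟙 (all? P? w) * h (x ∷ w))
  split x w = trans (cong (_* h (x ∷ w)) (𝟙-× (P? x) (all? P? w))) (*-assoc (𝟙 (P? x)) _ _)

∑-unique-wordsOver : ∀ A k (f : List ℕ → ℕ) →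
  ∑[ w ∈ wordsOver A k ] (𝟙 (unique? w) * f w) ≡ ∑ (arrangements A k) f
∑-unique-wordsOver A zero    f = cong (_+ 0) (*-identityˡ (f []))
∑-unique-wordsOver A (suc k) f = begin
  ∑[ w ∈ wordsOver A (suc k) ] (𝟙 (unique? w) * f w)
    ≡⟨ ∑-prepend A (λ _ → wordsOver A k) _ ⟩
  ∑[ x ∈ A ] ∑[ w ∈ wordsOver A k ] (𝟙 (unique? (x ∷ w)) * f (x ∷ w))
    ≡⟨ ∑-cong A (λ {x} _ → ∑-cong (wordsOver A k) (λ {w} _ → split x w)) ⟩
  ∑[ x ∈ A ] ∑[ w ∈ wordsOver A k ] (𝟙 (all? (λ y → ¬? (x ≟ y)) w) * (𝟙 (unique? w) * f (x ∷ w)))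
    ≡⟨ ∑-cong A (λ {x} _ → ∑-wordsOver-filter (λ y → ¬? (x ≟ y)) A k _) ⟩
  ∑[ x ∈ A ] ∑[ w ∈ wordsOver (A ∖ x) k ] (𝟙 (unique? w) * f (x ∷ w))
    ≡⟨ ∑-cong A (λ {x} _ → ∑-unique-wordsOver (A ∖ x) k (λ w → f (x ∷ w))) ⟩
  ∑[ x ∈ A ] ∑[ w ∈ arrangements (A ∖ x) k ] f (x ∷ w)
    ≡⟨ sym (∑-arrangements-∷ A k f) ⟩
  ∑ (arrangements A (suc k)) f
    ∎
  where
  open ≡-Reasoning
  split : ∀ x w →
    𝟙 (unique? (x ∷ w)) * f (x ∷ w) ≡ 𝟙 (all? (λ y → ¬? (x ≟ y)) w) * (𝟙 (unique? w) * f (x ∷ w))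
  split x w = trans (cong (_* f (x ∷ w)) (𝟙-× (all? _ w) (unique? w))) (*-assoc (𝟙 (all? _ w)) _ _)

d≡∑-arrangements : ∀ n i j →
  d n i j ≡ ∑[ w ∈ arrangements (map suc (upTo n)) n ] 𝟙 (children w i ≟ j)
d≡∑-arrangements n i j = begin
  d n i j
    ≡⟨ length-filter (λ w → children w i ≟ j) (perms n) ⟩
  ∑[ w ∈ filter unique? (words n n) ] 𝟙 (children w i ≟ j)
    ≡⟨ ∑-filter unique? (words n n) _ ⟩
  ∑[ w ∈ words n n ] (𝟙 (unique? w) * 𝟙 (children w i ≟ j))
    ≡⟨ cong (λ W → ∑[ w ∈ W ] (𝟙 (unique? w) * 𝟙 (children w i ≟ j))) (words≡wordsOver n n) ⟩
  ∑[ w ∈ wordsOver (map suc (upTo n)) n ] (𝟙 (unique? w) * 𝟙 (children w i ≟ j))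
    ≡⟨ ∑-unique-wordsOver (map suc (upTo n)) n _ ⟩
  ∑[ w ∈ arrangements (map suc (upTo n)) n ] 𝟙 (children w i ≟ j)
    ∎
  where open ≡-Reasoning

-- Extrema and the root of the minmax tree

minOf : List ℕ → ℕ
minOf []      = 0
minOf (y ∷ l) = foldr _⊓_ y l

maxOf : List ℕ → ℕ
maxOf []      = 0
maxOf (y ∷ l) = foldr _⊔_ y l

minOf-∈ : ∀ {x} w → x ∈ w → minOf w ∈ w
minOf-∈ (y ∷ l) _ with foldr-selective ⊓-sel y l
... | inj₁ ≡y = here ≡y
... | inj₂ ∈l = there ∈l

maxOf-∈ : ∀ {x} w → x ∈ w → maxOf w ∈ w
maxOf-∈ (y ∷ l) _ with foldr-selective ⊔-sel y l
... | inj₁ ≡y = here ≡y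
... | inj₂ ∈l = there ∈l

minOf-≤ : ∀ {x} w → x ∈ w → minOf w ≤ x
minOf-≤ (y ∷ [])    (here refl)         = ≤-refl
minOf-≤ (y ∷ z ∷ l) (here refl)         = ≤-trans (m⊓n≤n z _) (minOf-≤ (y ∷ l) (here refl))
minOf-≤ (y ∷ z ∷ l) (there (here refl)) = m⊓n≤m z _
minOf-≤ (y ∷ z ∷ l) (there (there x∈))  = ≤-trans (m⊓n≤n z _) (minOf-≤ (y ∷ l) (there x∈))

maxOf-≥ : ∀ {x} w → x ∈ w → x ≤ maxOf w
maxOf-≥ (y ∷ [])    (here refl)         = ≤-refl
maxOf-≥ (y ∷ z ∷ l) (here refl)         = ≤-trans (maxOf-≥ (y ∷ l) (here refl)) (m≤n⊔m z _)
maxOf-≥ (y ∷ z ∷ l) (there (here refl)) = m≤m⊔n z _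
maxOf-≥ (y ∷ z ∷ l) (there (there x∈))  = ≤-trans (maxOf-≥ (y ∷ l) (there x∈)) (m≤n⊔m z _)

minOf-≡ : ∀ {m} w → m ∈ w → (∀ {x} → x ∈ w → m ≤ x) → minOf w ≡ m
minOf-≡ w m∈ m≤ = ≤-antisym (minOf-≤ w m∈) (m≤ (minOf-∈ w m∈))

maxOf-≡ : ∀ {m} w → m ∈ w → (∀ {x} → x ∈ w → x ≤ m) → maxOf w ≡ m
maxOf-≡ w m∈ ≤m = ≤-antisym (≤m (maxOf-∈ w m∈)) (maxOf-≥ w m∈)

minOf≢maxOf : ∀ S → Unique S → 2 ≤ length S → minOf S ≢ maxOf S
minOf≢maxOf (a ∷ [])    _ (s≤s ())
minOf≢maxOf (a ∷ b ∷ S) ((a≢b ∷ _) ∷ _) _ min≡max =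
  a≢b (≤-antisym (squeeze (here refl) (there (here refl))) (squeeze (there (here refl)) (here refl)))
  where
  squeeze : ∀ {x y} → x ∈ a ∷ b ∷ S → y ∈ a ∷ b ∷ S → x ≤ y
  squeeze x∈ y∈ = ≤-trans (maxOf-≥ _ x∈) (subst (_≤ _) min≡max (minOf-≤ _ y∈))

record FirstHit (a b : ℕ) (w u : List ℕ) (m : ℕ) (v : List ℕ) : Set where
  constructor firstHit
  field
    decomposition : w ≡ u ++ m ∷ v
    hit           : m ≡ a ⊎ m ≡ b
    miss          : All (λ x → x ≢ a × x ≢ b) u

splitMM-firstHit : ∀ {a b w u m v} → FirstHit a b w u m v → splitMM a b w ≡ (u , m , v)
splitMM-firstHit {a} {b} {u = []} {m} (firstHit refl hit []) with m ≟ a | m ≟ b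
... | yes _   | _       = refl
... | no _    | yes _   = refl
... | no m≢a  | no m≢b  = ⊥-elim ([ m≢a , m≢b ]′ hit)
splitMM-firstHit {a} {b} {u = y ∷ u} (firstHit refl hit ((y≢a , y≢b) ∷ miss)) with y ≟ a | y ≟ b
... | yes y≡a | _       = ⊥-elim (y≢a y≡a)
... | no _    | yes y≡b = ⊥-elim (y≢b y≡b)
... | no _    | no _    = cong (λ s → y ∷ proj₁ s , proj₂ s) (splitMM-firstHit (firstHit refl hit miss))

firstHit-exists : ∀ {a b} w → a ∈ w ⊎ b ∈ w → ∃[ u ] ∃[ m ] ∃[ v ] FirstHit a b w u m v
firstHit-exists []      (inj₁ ())
firstHit-exists []      (inj₂ ())
firstHit-exists {a} {b} (x ∷ w) a∈⊎b∈ with x ≟ a | x ≟ b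
... | yes x≡a | _       = [] , x , w , firstHit refl (inj₁ x≡a) []
... | no _    | yes x≡b = [] , x , w , firstHit refl (inj₂ x≡b) []
... | no x≢a  | no x≢b  with firstHit-exists w (inTail a∈⊎b∈)
  where
  inTail : a ∈ x ∷ w ⊎ b ∈ x ∷ w → a ∈ w ⊎ b ∈ w
  inTail (inj₁ (here a≡x)) = ⊥-elim (x≢a (sym a≡x))
  inTail (inj₁ (there a∈)) = inj₁ a∈
  inTail (inj₂ (here b≡x)) = ⊥-elim (x≢b (sym b≡x))
  inTail (inj₂ (there b∈)) = inj₂ b∈
...   | u , m , v , firstHit w≡ hit miss =
  x ∷ u , m , v , firstHit (cong (x ∷_) w≡) hit ((x≢a , x≢b) ∷ miss)

length-left< : ∀ (u : List ℕ) m v → length u < length (u ++ m ∷ v)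
length-left< []      m v = s≤s z≤n
length-left< (x ∷ u) m v = s≤s (length-left< u m v)

length-right< : ∀ (u : List ℕ) m v → length v < length (u ++ m ∷ v)
length-right< []      m v = ≤-refl
length-right< (x ∷ u) m v = m≤n⇒m≤1+n (length-right< u m v)

firstHit-root : ∀ y l → ∃[ u ] ∃[ m ] ∃[ v ] FirstHit (minOf (y ∷ l)) (maxOf (y ∷ l)) (y ∷ l) u m v
firstHit-root y l = firstHit-exists (y ∷ l) (inj₁ (minOf-∈ (y ∷ l) (here refl)))

firstHit-left< : ∀ {a b w u m v} → FirstHit a b w u m v → length u < length w
firstHit-left< {u = u} {m} {v} (firstHit refl _ _) = length-left< u m v

firstHit-right< : ∀ {a b w u m v} → FirstHit a b w u m v → length v < length w
firstHit-right< {u = u} {m} {v} (firstHit refl _ _) = length-right< u m v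

minmaxTreeF-fuel : ∀ k k' w → length w ≤ k → length w ≤ k' → minmaxTreeF k w ≡ minmaxTreeF k' w
minmaxTreeF-fuel zero    zero     []       _ _ = refl
minmaxTreeF-fuel zero    (suc k') []       _ _ = refl
minmaxTreeF-fuel (suc k) zero     []       _ _ = refl
minmaxTreeF-fuel (suc k) (suc k') []       _ _ = refl
minmaxTreeF-fuel (suc k) (suc k') (x ∷ xs) (s≤s ≤k) (s≤s ≤k') with firstHit-root x xs
... | u , m , v , fh rewrite splitMM-firstHit {a = foldr _⊓_ x xs} {b = foldr _⊔_ x xs} fh =
  cong₂ (λ l r → node l m r) (minmaxTreeF-fuel k k' u (≤-trans u≤ ≤k) (≤-trans u≤ ≤k'))
                             (minmaxTreeF-fuel k k' v (≤-trans v≤ ≤k) (≤-trans v≤ ≤k'))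
  where
  u≤ : length u ≤ length xs
  u≤ = ≤-pred (firstHit-left< fh)
  v≤ : length v ≤ length xs
  v≤ = ≤-pred (firstHit-right< fh)

minmaxTree-firstHit : ∀ {w u m v} → FirstHit (minOf w) (maxOf w) w u m v →
  minmaxTree w ≡ node (minmaxTree u) m (minmaxTree v)
minmaxTree-firstHit {[]} {[]}    (firstHit () _ _)
minmaxTree-firstHit {[]} {_ ∷ _} (firstHit () _ _)
minmaxTree-firstHit {y ∷ l} {u} {m} {v} fh
  rewrite splitMM-firstHit {a = foldr _⊓_ y l} {b = foldr _⊔_ y l} fh =
  cong₂ (λ t r → node t m r) (minmaxTreeF-fuel (length l) (length u) u (≤-pred (firstHit-left< fh)) ≤-refl)
                             (minmaxTreeF-fuel (length l) (length v) v (≤-pred (firstHit-right< fh)) ≤-refl)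

-- Prepending a letter

childrenOf-root : ∀ a l r → childrenOf a (node l a r) ≡ nonempty l + nonempty r
childrenOf-root a l r with a ≟ a
... | yes _   = refl
... | no a≢a = ⊥-elim (a≢a refl)

childrenOf-node : ∀ {a m} l r → a ≢ m → childrenOf a (node l m r) ≡ childrenOf a l + childrenOf a r
childrenOf-node {a} {m} l r a≢m with a ≟ m
... | yes a≡m = ⊥-elim (a≢m a≡m)
... | no _    = refl

∈-left : ∀ {a : ℕ} u m v → a ∈ u → a ∈ u ++ m ∷ v
∈-left u m v = ∈-++⁺ˡ

∈-root : ∀ (u : List ℕ) m v → m ∈ u ++ m ∷ v
∈-root u m v = ∈-++⁺ʳ u (here refl)

∈-right : ∀ {a : ℕ} u m v → a ∈ v → a ∈ u ++ m ∷ v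
∈-right u m v = ∈-++⁺ʳ u ∘ there

childrenOf-∉F : ∀ {a} k w → a ∉ w → childrenOf a (minmaxTreeF k w) ≡ 0
childrenOf-∉F     zero    w        a∉ = refl
childrenOf-∉F     (suc k) []       a∉ = refl
childrenOf-∉F {a} (suc k) (x ∷ xs) a∉ with firstHit-root x xs
... | u , m , v , fh rewrite splitMM-firstHit {a = foldr _⊓_ x xs} {b = foldr _⊔_ x xs} fh =
  trans (childrenOf-node _ _ a≢m) (cong₂ _+_ (childrenOf-∉F k u (a∉ ∘ ∈w ∘ ∈-left u m v))
                                             (childrenOf-∉F k v (a∉ ∘ ∈w ∘ ∈-right u m v)))
  where
  ∈w : ∀ {b} → b ∈ u ++ m ∷ v → b ∈ x ∷ xs
  ∈w = subst (_ ∈_) (sym (FirstHit.decomposition fh))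
  a≢m : a ≢ m
  a≢m refl = a∉ (∈w (∈-root u m v))

childrenOf-∉ : ∀ {a} w → a ∉ w → childrenOf a (minmaxTree w) ≡ 0
childrenOf-∉ w = childrenOf-∉F (length w) w

childrenOf-left : ∀ {a m} t v → a ≢ m → a ∉ v → childrenOf a (node t m (minmaxTree v)) ≡ childrenOf a t
childrenOf-left t v a≢m a∉v =
  trans (childrenOf-node t _ a≢m) (trans (cong (childrenOf _ t +_) (childrenOf-∉ v a∉v)) (+-identityʳ _))

++-unique⁻ˡ : ∀ (xs : List ℕ) {ys} → Unique (xs ++ ys) → Unique xs
++-unique⁻ˡ []       _          = []
++-unique⁻ˡ (x ∷ xs) (x∉ ∷ xs!) = ++⁻ˡ xs x∉ ∷ ++-unique⁻ˡ xs xs!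

++-disjoint : ∀ (xs : List ℕ) {ys a} → Unique (xs ++ ys) → a ∈ xs → a ∉ ys
++-disjoint (x ∷ xs) u@(_ ∷ _) (here refl) a∈ys = Unique[x∷xs]⇒x∉xs u (∈-++⁺ʳ xs a∈ys)
++-disjoint (x ∷ xs) (_ ∷ xs!)  (there a∈)  a∈ys = ++-disjoint xs xs! a∈ a∈ys

children-firstHit-[] : ∀ {w m v} → FirstHit (minOf w) (maxOf w) w [] m v →
  children w 1 ≡ nonempty (minmaxTree v)
children-firstHit-[] {m = m} {v} fh@(firstHit refl _ _) =
  trans (cong (childrenOf m) (minmaxTree-firstHit fh)) (childrenOf-root m leaf (minmaxTree v))

children-firstHit-∷ : ∀ {w y u m v} → Unique w → FirstHit (minOf w) (maxOf w) w (y ∷ u) m v →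
  children w 1 ≡ children (y ∷ u) 1
children-firstHit-∷ {y = y} {u} {m} {v} w! fh@(firstHit refl _ _) =
  trans (cong (childrenOf y) (minmaxTree-firstHit fh)) (childrenOf-left _ v (y∉ ∘ here) (y∉ ∘ there))
  where
  y∉ : y ∉ m ∷ v
  y∉ = ++-disjoint (y ∷ u) w! (here refl)

firstHit-nonsingleton : ∀ {a b w u m v} → minOf w < maxOf w → FirstHit a b w u m v → u ≡ [] → v ≢ []
firstHit-nonsingleton min<max (firstHit refl _ _) refl refl = <-irrefl refl min<max

data ConsView (x : ℕ) (w : List ℕ) : Set where
  newRoot : minmaxTree (x ∷ w) ≡ node leaf x (minmaxTree w) → ConsView x w
  descend : ∀ {u m v} → FirstHit (minOf w) (maxOf w) w u m v → (u ≡ [] → v ≢ []) →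
            minmaxTree (x ∷ w) ≡ node (minmaxTree (x ∷ u)) m (minmaxTree v) → ConsView x w

consView : ∀ x y l → x ∉ y ∷ l → ConsView x (y ∷ l)
consView x y l x∉ with <-cmp x (minOf (y ∷ l)) | <-cmp x (maxOf (y ∷ l))
... | tri≈ _ x≡min _ | _ = ⊥-elim (x∉ (subst (_∈ y ∷ l) (sym x≡min) (minOf-∈ (y ∷ l) (here refl))))
... | _ | tri≈ _ x≡max _ = ⊥-elim (x∉ (subst (_∈ y ∷ l) (sym x≡max) (maxOf-∈ (y ∷ l) (here refl))))
... | tri< x<min _ _ | _ = newRoot (minmaxTree-firstHit (firstHit refl (inj₁ (sym min≡x)) []))
  where
  min≡x : minOf (x ∷ y ∷ l) ≡ x
  min≡x = minOf-≡ (x ∷ y ∷ l) (here refl)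
            (λ { (here refl) → ≤-refl ; (there z∈) → ≤-trans (<⇒≤ x<min) (minOf-≤ (y ∷ l) z∈) })
... | _ | tri> _ _ max<x = newRoot (minmaxTree-firstHit (firstHit refl (inj₂ (sym max≡x)) []))
  where
  max≡x : maxOf (x ∷ y ∷ l) ≡ x
  max≡x = maxOf-≡ (x ∷ y ∷ l) (here refl)
            (λ { (here refl) → ≤-refl ; (there z∈) → ≤-trans (maxOf-≥ (y ∷ l) z∈) (<⇒≤ max<x) })
... | tri> _ _ min<x | tri< x<max _ _ with firstHit-root y l
...   | u , m , v , fh@(firstHit w≡ hit miss) =
  descend fh (firstHit-nonsingleton (<-trans min<x x<max) fh)
    (minmaxTree-firstHit (subst₂ (λ a b → FirstHit a b (x ∷ y ∷ l) (x ∷ u) m v) (sym min≡) (sym max≡)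
                            (firstHit (cong (x ∷_) w≡) hit ((<⇒≢ min<x ∘ sym , <⇒≢ x<max) ∷ miss))))
  where
  min≡ : minOf (x ∷ y ∷ l) ≡ minOf (y ∷ l)
  min≡ = minOf-≡ (x ∷ y ∷ l) (there (minOf-∈ (y ∷ l) (here refl)))
           (λ { (here refl) → <⇒≤ min<x ; (there z∈) → minOf-≤ (y ∷ l) z∈ })
  max≡ : maxOf (x ∷ y ∷ l) ≡ maxOf (y ∷ l)
  max≡ = maxOf-≡ (x ∷ y ∷ l) (there (maxOf-∈ (y ∷ l) (here refl)))
           (λ { (here refl) → <⇒≤ x<max ; (there z∈) → maxOf-≥ (y ∷ l) z∈ })


nonempty-minmaxTree : ∀ v → v ≢ [] → nonempty (minmaxTree v) ≡ 1
nonempty-minmaxTree []      v≢[] = ⊥-elim (v≢[] refl)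
nonempty-minmaxTree (_ ∷ _) _    = refl

minmaxTree-singleton : ∀ x → minmaxTree [ x ] ≡ node leaf x leaf
minmaxTree-singleton x = minmaxTree-firstHit (firstHit refl (inj₁ refl) [])

firstHit-unique-left : ∀ {a b w u m v} → FirstHit a b w u m v → Unique w → Unique u
firstHit-unique-left {u = u} (firstHit refl _ _) = ++-unique⁻ˡ u

children-first-≤1 : ∀ w → Unique w → children w 1 ≤ 1
children-first-≤1 w = go w (<-wellFounded (length w))
  where
  go : ∀ w → Acc _<_ (length w) → Unique w → children w 1 ≤ 1
  go []      _         _  = z≤n
  go (y ∷ l) (acc rec) w! with firstHit-root y l
  ... | []     , m , v , fh =
    subst (_≤ 1) (sym (children-firstHit-[] fh)) (nonempty≤1 (minmaxTree v))
    where
    nonempty≤1 : ∀ t → nonempty t ≤ 1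
    nonempty≤1 leaf         = z≤n
    nonempty≤1 (node _ _ _) = s≤s z≤n
  ... | y' ∷ u , m , v , fh =
    subst (_≤ 1) (sym (children-firstHit-∷ w! fh))
      (go (y' ∷ u) (rec (firstHit-left< fh)) (firstHit-unique-left fh w!))

data Prepended (x y : ℕ) (l : List ℕ) : Set where
  internal  : children (x ∷ y ∷ l) 1 ≡ 1 → children (x ∷ y ∷ l) 2 ≡ children (y ∷ l) 1 →
              Prepended x y l
  leafUnder : children (x ∷ y ∷ l) 1 ≡ 0 → children (y ∷ l) 1 ≡ 1 → children (x ∷ y ∷ l) 2 ≡ 2 →
              Prepended x y l

prepended-lift : ∀ {x y u m v} → Unique (x ∷ y ∷ u ++ m ∷ v) →
  FirstHit (minOf (y ∷ u ++ m ∷ v)) (maxOf (y ∷ u ++ m ∷ v)) (y ∷ u ++ m ∷ v) (y ∷ u) m v →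
  minmaxTree (x ∷ y ∷ u ++ m ∷ v) ≡ node (minmaxTree (x ∷ y ∷ u)) m (minmaxTree v) →
  Prepended x y u → Prepended x y (u ++ m ∷ v)
prepended-lift {x} {y} {u} {m} {v} xw!@(_ ∷ w!) fh eq = lift
  where
  x∉ : x ∉ m ∷ v
  x∉ = ++-disjoint (x ∷ y ∷ u) xw! (here refl)
  y∉ : y ∉ m ∷ v
  y∉ = ++-disjoint (y ∷ u) w! (here refl)
  first : children (x ∷ y ∷ u ++ m ∷ v) 1 ≡ children (x ∷ y ∷ u) 1
  first = trans (cong (childrenOf x) eq) (childrenOf-left _ v (x∉ ∘ here) (x∉ ∘ there))
  second : children (x ∷ y ∷ u ++ m ∷ v) 2 ≡ children (x ∷ y ∷ u) 2
  second = trans (cong (childrenOf y) eq) (childrenOf-left _ v (y∉ ∘ here) (y∉ ∘ there))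
  lift : Prepended x y u → Prepended x y (u ++ m ∷ v)
  lift (internal c₁ c₂) =
    internal (trans first c₁) (trans second (trans c₂ (sym (children-firstHit-∷ w! fh))))
  lift (leafUnder c₁ c₁' c₂) =
    leafUnder (trans first c₁) (trans (children-firstHit-∷ w! fh) c₁') (trans second c₂)

prepended : ∀ x y l → Unique (x ∷ y ∷ l) → Prepended x y l
prepended x y l = go y l (<-wellFounded (length (y ∷ l)))
  where
  go : ∀ y l → Acc _<_ (length (y ∷ l)) → Unique (x ∷ y ∷ l) → Prepended x y l
  go y l (acc rec) xw! with consView x y l (Unique[x∷xs]⇒x∉xs xw!)
  ... | newRoot eq = internal
    (trans (cong (childrenOf x) eq) (childrenOf-root x leaf _))
    (trans (cong (childrenOf y) eq)
           (childrenOf-node leaf _ (λ y≡x → Unique[x∷xs]⇒x∉xs xw! (here (sym y≡x)))))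
  go m v (acc rec) xw! | descend {[]} fh@(firstHit refl _ _) nonsingleton eq = leafUnder
    (trans (cong (childrenOf x) eq)
      (trans (childrenOf-left _ v (x∉ ∘ here) (x∉ ∘ there))
        (trans (cong (childrenOf x) (minmaxTree-singleton x)) (childrenOf-root x leaf leaf))))
    (trans (children-firstHit-[] fh) v-nonempty)
    (trans (cong (childrenOf m) eq) (trans (childrenOf-root m _ _) (cong suc v-nonempty)))
    where
    x∉ : x ∉ m ∷ v
    x∉ = Unique[x∷xs]⇒x∉xs xw!
    v-nonempty : nonempty (minmaxTree v) ≡ 1
    v-nonempty = nonempty-minmaxTree v (nonsingleton refl)
  ... | descend {_ ∷ u} fh@(firstHit refl _ _) _ eq =
    prepended-lift xw! fh eq (go y u (rec (firstHit-left< fh)) (++-unique⁻ˡ (x ∷ y ∷ u) xw!))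

∈-cut⁻ : ∀ {a : ℕ} u m v → a ∈ u ++ m ∷ v → a ∈ u ⊎ a ≡ m ⊎ a ∈ v
∈-cut⁻ u m v a∈ with ∈-++⁻ u a∈
... | inj₁ a∈u         = inj₁ a∈u
... | inj₂ (here a≡m)  = inj₂ (inj₁ a≡m)
... | inj₂ (there a∈v) = inj₂ (inj₂ a∈v)

childrenOf-node-congˡ : ∀ {a m} t t' r → (a ≡ m → nonempty t ≡ nonempty t') →
  (a ≢ m → childrenOf a t ≡ childrenOf a t') → childrenOf a (node t m r) ≡ childrenOf a (node t' m r)
childrenOf-node-congˡ {a} {m} t t' r atRoot below with a ≟ m
... | yes a≡m = cong (_+ nonempty r) (atRoot a≡m)
... | no a≢m  = cong (_+ childrenOf a r) (below a≢m)

childrenOf-prepend : ∀ {a} x y l → Unique (x ∷ y ∷ l) → a ∈ l →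
  childrenOf a (minmaxTree (x ∷ y ∷ l)) ≡ childrenOf a (minmaxTree (y ∷ l))
childrenOf-prepend {a} x y l = go y l (<-wellFounded (length (y ∷ l)))
  where
  go : ∀ y l → Acc _<_ (length (y ∷ l)) → Unique (x ∷ y ∷ l) → a ∈ l →
       childrenOf a (minmaxTree (x ∷ y ∷ l)) ≡ childrenOf a (minmaxTree (y ∷ l))
  go y l (acc rec) xw!@(_ ∷ w!) a∈l with consView x y l (Unique[x∷xs]⇒x∉xs xw!)
  ... | newRoot eq = trans (cong (childrenOf a) eq) (childrenOf-node leaf _ a≢x)
    where
    a≢x : a ≢ x
    a≢x refl = Unique[x∷xs]⇒x∉xs xw! (there a∈l)
  go m v (acc rec) xw!@(_ ∷ w!) a∈v | descend {[]} fh@(firstHit refl _ _) _ eq =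
    trans (cong (childrenOf a) eq)
      (trans (childrenOf-node-congˡ {a} {m} (minmaxTree [ x ]) leaf (minmaxTree v)
                (λ { refl → ⊥-elim (Unique[x∷xs]⇒x∉xs w! a∈v) }) (λ _ → a∉[x]))
             (cong (childrenOf a) (sym (minmaxTree-firstHit fh))))
    where
    a∉[x] : childrenOf a (minmaxTree [ x ]) ≡ 0
    a∉[x] = childrenOf-∉ {a} [ x ] (λ { (here refl) → Unique[x∷xs]⇒x∉xs xw! (there a∈v) })
  go y _ (acc rec) xw!@(_ ∷ w!) a∈l | descend {_ ∷ u} {m} {v} fh@(firstHit refl _ _) _ eq =
    trans (cong (childrenOf a) eq)
      (trans (childrenOf-node-congˡ {a} {m} _ _ (minmaxTree v) (λ _ → refl) below)
             (cong (childrenOf a) (sym (minmaxTree-firstHit fh))))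
    where
    below : a ≢ m → childrenOf a (minmaxTree (x ∷ y ∷ u)) ≡ childrenOf a (minmaxTree (y ∷ u))
    below a≢m with ∈-cut⁻ u m v a∈l
    ... | inj₁ a∈u        = go y u (rec (firstHit-left< fh)) (++-unique⁻ˡ (x ∷ y ∷ u) xw!) a∈u
    ... | inj₂ (inj₁ a≡m) = ⊥-elim (a≢m a≡m)
    ... | inj₂ (inj₂ a∈v) =
      trans (childrenOf-∉ (x ∷ y ∷ u) (a∉ (x ∷ y ∷ u) xw!))
            (sym (childrenOf-∉ (y ∷ u) (a∉ (y ∷ u) w!)))
      where
      a∉ : ∀ p → Unique (p ++ m ∷ v) → a ∉ p
      a∉ p p! a∈p = ++-disjoint p p! a∈p (there a∈v)

-- Appending a letter

∈-∷ʳ⁻ : ∀ {x : ℕ} w z → x ∈ w ∷ʳ z → x ∈ w ⊎ x ≡ z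
∈-∷ʳ⁻ w z x∈ with ∈-++⁻ w x∈
... | inj₁ x∈w        = inj₁ x∈w
... | inj₂ (here x≡z) = inj₂ x≡z

minOf-∷ʳ : ∀ {x} w z → x ∈ w → minOf w ≤ z → minOf (w ∷ʳ z) ≡ minOf w
minOf-∷ʳ w z x∈ min≤z = minOf-≡ (w ∷ʳ z) (∈-++⁺ˡ (minOf-∈ w x∈)) bound
  where
  bound : ∀ {y} → y ∈ w ∷ʳ z → minOf w ≤ y
  bound y∈ with ∈-∷ʳ⁻ w z y∈
  ... | inj₁ y∈w  = minOf-≤ w y∈w
  ... | inj₂ refl = min≤z

maxOf-∷ʳ : ∀ {x} w z → x ∈ w → z ≤ maxOf w → maxOf (w ∷ʳ z) ≡ maxOf w
maxOf-∷ʳ w z x∈ z≤max = maxOf-≡ (w ∷ʳ z) (∈-++⁺ˡ (maxOf-∈ w x∈)) bound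
  where
  bound : ∀ {y} → y ∈ w ∷ʳ z → y ≤ maxOf w
  bound y∈ with ∈-∷ʳ⁻ w z y∈
  ... | inj₁ y∈w  = maxOf-≥ w y∈w
  ... | inj₂ refl = z≤max

minOf-∷ʳ-new : ∀ w z → (∀ {x} → x ∈ w → z ≤ x) → minOf (w ∷ʳ z) ≡ z
minOf-∷ʳ-new w z z≤ = minOf-≡ (w ∷ʳ z) (∈-++⁺ʳ w (here refl)) bound
  where
  bound : ∀ {y} → y ∈ w ∷ʳ z → z ≤ y
  bound y∈ with ∈-∷ʳ⁻ w z y∈
  ... | inj₁ y∈w  = z≤ y∈w
  ... | inj₂ refl = ≤-refl

maxOf-∷ʳ-new : ∀ w z → (∀ {x} → x ∈ w → x ≤ z) → maxOf (w ∷ʳ z) ≡ z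
maxOf-∷ʳ-new w z ≤z = maxOf-≡ (w ∷ʳ z) (∈-++⁺ʳ w (here refl)) bound
  where
  bound : ∀ {y} → y ∈ w ∷ʳ z → y ≤ z
  bound y∈ with ∈-∷ʳ⁻ w z y∈
  ... | inj₁ y∈w  = ≤z y∈w
  ... | inj₂ refl = ≤-refl

∷ʳ≢[] : ∀ (v : List ℕ) z → v ∷ʳ z ≢ []
∷ʳ≢[] []      _ ()
∷ʳ≢[] (_ ∷ _) _ ()

Unique-∷ʳ⇒∉ : ∀ w {z : ℕ} → Unique (w ∷ʳ z) → z ∉ w
Unique-∷ʳ⇒∉ w wz! z∈w = ++-disjoint w wz! z∈w (here refl)

firstHit-∷ʳ : ∀ {a b w u m v} z → FirstHit a b w u m v → FirstHit a b (w ∷ʳ z) u m (v ∷ʳ z)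
firstHit-∷ʳ {u = u} {m} {v} z (firstHit refl hit miss) = firstHit (++-assoc u (m ∷ v) [ z ]) hit miss

firstHit-swap : ∀ {a b w u m v} → FirstHit a b w u m v → FirstHit b a w u m v
firstHit-swap (firstHit w≡ hit miss) = firstHit w≡ (swap⊎ hit) (All.map swap miss)

firstHit-widen : ∀ {a b w u m v} → b ∉ w → FirstHit a a w u m v → FirstHit a b w u m v
firstHit-widen {a} {b} {u = u} {m} {v} b∉ (firstHit refl hit miss) =
  firstHit refl (inj₁ (reduce hit)) (All.tabulate avoid)
  where
  avoid : ∀ {x} → x ∈ u → x ≢ a × x ≢ b
  avoid x∈u = proj₁ (All.lookup miss x∈u) , λ { refl → b∉ (∈-left u m v x∈u) }

-- The number of children of the first letter of u ++ m ∷ v when m is the root and v ≢ []; for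
-- u = [] that letter is m itself.
firstChildren⁺ : List ℕ → ℕ
firstChildren⁺ []      = 1
firstChildren⁺ (y ∷ u) = children (y ∷ u) 1

children-firstHit : ∀ {w u m v} → Unique w → FirstHit (minOf w) (maxOf w) w u m v → (u ≡ [] → v ≢ []) →
  children w 1 ≡ firstChildren⁺ u
children-firstHit {u = []}    {v = v} _  fh v≢[] =
  trans (children-firstHit-[] fh) (nonempty-minmaxTree v (v≢[] refl))
children-firstHit {u = _ ∷ _}         w! fh _    = children-firstHit-∷ w! fh

beforeFirst : ℕ → List ℕ → List ℕ
beforeFirst a w = proj₁ (splitMM a a w)

beforeFirst-∷ʳ : ∀ {a} w z → a ∈ w → beforeFirst a (w ∷ʳ z) ≡ beforeFirst a w
beforeFirst-∷ʳ w z a∈ with firstHit-exists w (inj₁ a∈)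
... | u , m , v , fh = trans (cong proj₁ (splitMM-firstHit (firstHit-∷ʳ z fh)))
                             (sym (cong proj₁ (splitMM-firstHit fh)))

beforeFirst-∷ʳ-new : ∀ w z → z ∉ w → beforeFirst z (w ∷ʳ z) ≡ w
beforeFirst-∷ʳ-new w z z∉ =
  cong proj₁ (splitMM-firstHit (firstHit {v = []} refl (inj₁ refl) (All.tabulate (λ x∈ → ≢z x∈ , ≢z x∈))))
  where
  ≢z : ∀ {x} → x ∈ w → x ≢ z
  ≢z x∈ refl = z∉ x∈

children-∷ʳ-inner : ∀ w z → Unique (w ∷ʳ z) → minOf w < z → z < maxOf w →
  children (w ∷ʳ z) 1 ≡ children w 1
children-∷ʳ-inner []      z _   min<z z<max = ⊥-elim (<-irrefl refl (<-trans min<z z<max))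
children-∷ʳ-inner (y ∷ l) z wz! min<z z<max with firstHit-root y l
... | u , m , v , fh = trans (children-firstHit wz! fhz (λ _ → ∷ʳ≢[] v z))
                             (sym (children-firstHit w! fh (firstHit-nonsingleton (<-trans min<z z<max) fh)))
  where
  w = y ∷ l
  w! : Unique w
  w! = ++-unique⁻ˡ w wz!
  fhz : FirstHit (minOf (w ∷ʳ z)) (maxOf (w ∷ʳ z)) (w ∷ʳ z) u m (v ∷ʳ z)
  fhz = subst₂ (λ a b → FirstHit a b (w ∷ʳ z) u m (v ∷ʳ z))
          (sym (minOf-∷ʳ w z (here refl) (<⇒≤ min<z))) (sym (maxOf-∷ʳ w z (here refl) (<⇒≤ z<max)))
          (firstHit-∷ʳ z fh)

children-∷ʳ-outer : ∀ {a} w z → Unique (w ∷ʳ z) → a ∈ w →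
  (minOf (w ∷ʳ z) ≡ a × maxOf (w ∷ʳ z) ≡ z) ⊎ (minOf (w ∷ʳ z) ≡ z × maxOf (w ∷ʳ z) ≡ a) →
  children (w ∷ʳ z) 1 ≡ firstChildren⁺ (beforeFirst a w)
children-∷ʳ-outer {a} w z wz! a∈ extremes with firstHit-exists w (inj₁ a∈)
... | u , m , v , fh = begin
  children (w ∷ʳ z) 1          ≡⟨ children-firstHit wz! (extremal extremes) (λ _ → ∷ʳ≢[] v z) ⟩
  firstChildren⁺ u             ≡⟨ cong (firstChildren⁺ ∘ proj₁) (sym (splitMM-firstHit fh)) ⟩
  firstChildren⁺ (beforeFirst a w) ∎
  where
  open ≡-Reasoning
  Hit : ℕ → ℕ → Set
  Hit a b = FirstHit a b (w ∷ʳ z) u m (v ∷ʳ z)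
  fhz : Hit a z
  fhz = firstHit-∷ʳ z (firstHit-widen (Unique-∷ʳ⇒∉ w wz!) fh)
  extremal : (minOf (w ∷ʳ z) ≡ a × maxOf (w ∷ʳ z) ≡ z) ⊎ (minOf (w ∷ʳ z) ≡ z × maxOf (w ∷ʳ z) ≡ a) →
             Hit (minOf (w ∷ʳ z)) (maxOf (w ∷ʳ z))
  extremal (inj₁ (min≡ , max≡)) = subst₂ Hit (sym min≡) (sym max≡) fhz
  extremal (inj₂ (min≡ , max≡)) = subst₂ Hit (sym min≡) (sym max≡) (firstHit-swap fhz)

-- Arrangements whose first letter is a leaf

beforeMin beforeMax : List ℕ → List ℕ
beforeMin w = beforeFirst (minOf w) w
beforeMax w = beforeFirst (maxOf w) w

length≡suc⇒∈ : ∀ {w : List ℕ} {k} → length w ≡ suc k → ∃[ y ] y ∈ w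
length≡suc⇒∈ {y ∷ _} _ = y , here refl

firstChildren⁺-nonempty : ∀ w {k} → length w ≡ suc k → firstChildren⁺ w ≡ children w 1
firstChildren⁺-nonempty (_ ∷ _) _ = refl

module Appended (S : List ℕ) (S! : Unique S) (n : ℕ) (∣S∣ : length S ≡ suc (suc n))
                {z} (z∈S : z ∈ S) {w} (w∈ : w ∈ arrangements (S ∖ z) (suc n)) where

  private
    ⊆S : ∀ {x} → x ∈ w → x ∈ S × z ≢ x
    ⊆S x∈ = ∈-∖⁻ S (arrangement-⊆ (S ∖ z) (suc n) w∈ x∈)

    ⊇S : ∀ {x} → x ∈ S → z ≢ x → x ∈ w
    ⊇S x∈S z≢x = arrangement-⊇ (S ∖ z) (suc n) (∖-unique z S!) (length-∖ S S! z∈S ∣S∣)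
                   w∈ (∈-∖⁺ S x∈S z≢x)

    z∉w : z ∉ w
    z∉w = arrangement-∉ S z (suc n) w∈

    wz! : Unique (w ∷ʳ z)
    wz! = Unique.++⁺ (arrangement-unique (S ∖ z) (suc n) w∈) ([] ∷ [])
            (λ { (z∈w , here refl) → z∉w z∈w })

    letter : ∃[ y ] y ∈ w
    letter = length≡suc⇒∈ (arrangement-length (S ∖ z) (suc n) w∈)

    y : ℕ
    y = proj₁ letter

    y∈w : y ∈ w
    y∈w = proj₂ letter

    z-max⇒below : z ≡ maxOf S → ∀ {x} → x ∈ w → x < z
    z-max⇒below refl x∈ = ≤∧≢⇒< (maxOf-≥ S (proj₁ (⊆S x∈))) (proj₂ (⊆S x∈) ∘ sym)

    z-min⇒above : z ≡ minOf S → ∀ {x} → x ∈ w → z < x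
    z-min⇒above refl x∈ = ≤∧≢⇒< (minOf-≤ S (proj₁ (⊆S x∈))) (proj₂ (⊆S x∈))

    min≤z : z ≢ minOf S → minOf w ≤ z
    min≤z z≢min = ≤-trans (minOf-≤ w (⊇S (minOf-∈ S z∈S) z≢min)) (minOf-≤ S z∈S)

    z≤max : z ≢ maxOf S → z ≤ maxOf w
    z≤max z≢max = ≤-trans (maxOf-≥ S z∈S) (maxOf-≥ w (⊇S (maxOf-∈ S z∈S) z≢max))


  children-append-max : z ≡ maxOf S → children (w ∷ʳ z) 1 ≡ firstChildren⁺ (beforeMin w)
  children-append-max z≡max = children-∷ʳ-outer w z wz! (minOf-∈ w y∈w)
    (inj₁ (minOf-∷ʳ w z y∈w (≤-trans (minOf-≤ w y∈w) (<⇒≤ (z-max⇒below z≡max y∈w))) ,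
           maxOf-∷ʳ-new w z (<⇒≤ ∘ z-max⇒below z≡max)))

  children-append-min : z ≡ minOf S → children (w ∷ʳ z) 1 ≡ firstChildren⁺ (beforeMax w)
  children-append-min z≡min = children-∷ʳ-outer w z wz! (maxOf-∈ w y∈w)
    (inj₂ (minOf-∷ʳ-new w z (<⇒≤ ∘ z-min⇒above z≡min) ,
           maxOf-∷ʳ w z y∈w (≤-trans (<⇒≤ (z-min⇒above z≡min y∈w)) (maxOf-≥ w y∈w))))

  children-append-inner : z ≢ minOf S → z ≢ maxOf S → children (w ∷ʳ z) 1 ≡ children w 1
  children-append-inner z≢min z≢max = children-∷ʳ-inner w z wz!
    (≤∧≢⇒< (min≤z z≢min) (λ min≡z → z∉w (subst (_∈ w) min≡z (minOf-∈ w y∈w))))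
    (≤∧≢⇒< (z≤max z≢max) (λ z≡max → z∉w (subst (_∈ w) (sym z≡max) (maxOf-∈ w y∈w))))

  beforeMin-append-min : z ≡ minOf S → beforeMin (w ∷ʳ z) ≡ w
  beforeMin-append-min z≡min =
    trans (cong (λ a → beforeFirst a (w ∷ʳ z)) (minOf-∷ʳ-new w z (<⇒≤ ∘ z-min⇒above z≡min)))
          (beforeFirst-∷ʳ-new w z z∉w)

  beforeMin-append : z ≢ minOf S → beforeMin (w ∷ʳ z) ≡ beforeMin w
  beforeMin-append z≢min =
    trans (cong (λ a → beforeFirst a (w ∷ʳ z)) (minOf-∷ʳ w z y∈w (min≤z z≢min)))
          (beforeFirst-∷ʳ w z (minOf-∈ w y∈w))

  beforeMax-append-max : z ≡ maxOf S → beforeMax (w ∷ʳ z) ≡ w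
  beforeMax-append-max z≡max =
    trans (cong (λ a → beforeFirst a (w ∷ʳ z)) (maxOf-∷ʳ-new w z (<⇒≤ ∘ z-max⇒below z≡max)))
          (beforeFirst-∷ʳ-new w z z∉w)

  beforeMax-append : z ≢ maxOf S → beforeMax (w ∷ʳ z) ≡ beforeMax w
  beforeMax-append z≢max =
    trans (cong (λ a → beforeFirst a (w ∷ʳ z)) (maxOf-∷ʳ w z y∈w (z≤max z≢max)))
          (beforeFirst-∷ʳ w z (maxOf-∈ w y∈w))

-- minLeaves (maxLeaves) counts the arrangements w whose first letter becomes a leaf when a new
-- maximum (minimum) is appended to w.
firstLeaves minLeaves maxLeaves : List ℕ → ℕ → ℕ
firstLeaves S n = ∑[ w ∈ arrangements S n ] 𝟙 (children w 1 ≟ 0)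
minLeaves   S n = ∑[ w ∈ arrangements S n ] 𝟙 (firstChildren⁺ (beforeMin w) ≟ 0)
maxLeaves   S n = ∑[ w ∈ arrangements S n ] 𝟙 (firstChildren⁺ (beforeMax w) ≟ 0)

mutual
  ℓ : ℕ → ℕ
  ℓ zero          = 1
  ℓ (suc zero)    = 1
  ℓ (suc (suc k)) = g (suc k) + (g (suc k) + k * ℓ (suc k))

  g : ℕ → ℕ
  g zero          = 0
  g (suc zero)    = 0
  g (suc (suc k)) = ℓ (suc k) + suc k * g (suc k)

LeafCounts : ℕ → Set
LeafCounts n = ∀ S → Unique S → length S ≡ n →
  firstLeaves S n ≡ ℓ n × minLeaves S n ≡ g n × maxLeaves S n ≡ g n

leafCounts-1 : LeafCounts 1
leafCounts-1 (a ∷ []) _ _ =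
  cong (_+ 0) (𝟙-yes (trans (cong (childrenOf a) (minmaxTree-singleton a)) (childrenOf-root a leaf leaf))) ,
  cong (_+ 0) (𝟙-no (λ c≡0 → 1+n≢0 (trans (sym beforeSingleton) c≡0))) ,
  cong (_+ 0) (𝟙-no (λ c≡0 → 1+n≢0 (trans (sym beforeSingleton) c≡0)))
  where
  beforeSingleton : firstChildren⁺ (beforeFirst a [ a ]) ≡ 1
  beforeSingleton = cong firstChildren⁺ (beforeFirst-∷ʳ-new [] a (λ ()))

module LeafCountStep (k : ℕ) (IH : LeafCounts (suc k)) (S : List ℕ) (S! : Unique S)
                     (∣S∣ : length S ≡ suc (suc k)) where

  open Appended S S! k ∣S∣
  open ≡-Reasoning

  private
    n min max : ℕ
    n   = suc k
    min = minOf S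
    max = maxOf S

    ∣S∖_∣ : ∀ {z} → z ∈ S → length (S ∖ z) ≡ n
    ∣S∖ z∈S ∣ = length-∖ S S! z∈S ∣S∣

    IH∖ : ∀ {z} → z ∈ S →
      firstLeaves (S ∖ z) n ≡ ℓ n × minLeaves (S ∖ z) n ≡ g n × maxLeaves (S ∖ z) n ≡ g n
    IH∖ {z} z∈S = IH (S ∖ z) (∖-unique z S!) ∣S∖ z∈S ∣

    some∈S : ∃[ x ] x ∈ S
    some∈S = length≡suc⇒∈ ∣S∣

    min∈S : min ∈ S
    min∈S = minOf-∈ S (proj₂ some∈S)

    max∈S : max ∈ S
    max∈S = maxOf-∈ S (proj₂ some∈S)

    min∈S∖max : min ∈ S ∖ max
    min∈S∖max = ∈-∖⁺ S min∈S (minOf≢maxOf S S! (subst (2 ≤_) (sym ∣S∣) (s≤s (s≤s z≤n))) ∘ sym)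

    countAfter : (List ℕ → ℕ) → ℕ → ℕ
    countAfter φ z = ∑[ w ∈ arrangements (S ∖ z) n ] 𝟙 (φ (w ∷ʳ z) ≟ 0)

    countAfter-cong : ∀ (φ ψ : List ℕ → ℕ) {z} →
      (∀ {w} → w ∈ arrangements (S ∖ z) n → φ (w ∷ʳ z) ≡ ψ w) →
      countAfter φ z ≡ ∑[ w ∈ arrangements (S ∖ z) n ] 𝟙 (ψ w ≟ 0)
    countAfter-cong φ ψ {z} eq = ∑-cong _ (λ w∈ → cong (λ c → 𝟙 (c ≟ 0)) (eq w∈))

  firstLeaves-step : firstLeaves S (suc n) ≡ ℓ (suc n)
  firstLeaves-step = begin
    firstLeaves S (suc n)
      ≡⟨ ∑-arrangements-∷ʳ S n (λ w → 𝟙 (φ w ≟ 0)) ⟩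
    ∑[ z ∈ S ] countAfter φ z
      ≡⟨ ∑-∖ S (countAfter φ) S! max∈S ⟩
    countAfter φ max + ∑[ z ∈ S ∖ max ] countAfter φ z
      ≡⟨ cong (countAfter φ max +_) (∑-∖ (S ∖ max) (countAfter φ) (∖-unique max S!) min∈S∖max) ⟩
    countAfter φ max + (countAfter φ min + ∑[ z ∈ S ∖ max ∖ min ] countAfter φ z)
      ≡⟨ cong₂ (λ a b → a + (b + ∑[ z ∈ S ∖ max ∖ min ] countAfter φ z)) atMax atMin ⟩
    g n + (g n + ∑[ z ∈ S ∖ max ∖ min ] countAfter φ z)
      ≡⟨ cong (λ a → g n + (g n + a)) (∑-constOn (S ∖ max ∖ min) inner) ⟩
    g n + (g n + length (S ∖ max ∖ min) * ℓ n)
      ≡⟨ cong (λ a → g n + (g n + a * ℓ n)) ∣S∖max∖min∣ ⟩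
    ℓ (suc n)
      ∎
    where
    φ : List ℕ → ℕ
    φ w = children w 1
    atMax : countAfter φ max ≡ g n
    atMax = trans (countAfter-cong φ (firstChildren⁺ ∘ beforeMin) (λ w∈ → children-append-max max∈S w∈ refl))
                  (proj₁ (proj₂ (IH∖ max∈S)))
    atMin : countAfter φ min ≡ g n
    atMin = trans (countAfter-cong φ (firstChildren⁺ ∘ beforeMax) (λ w∈ → children-append-min min∈S w∈ refl))
                  (proj₂ (proj₂ (IH∖ min∈S)))
    inner : ∀ {z} → z ∈ S ∖ max ∖ min → countAfter φ z ≡ ℓ n
    inner z∈ with ∈-∖⁻ (S ∖ max) z∈
    ... | z∈S∖max , min≢z with ∈-∖⁻ S z∈S∖max
    ...   | z∈S , max≢z =
      trans (countAfter-cong φ φ (λ w∈ → children-append-inner z∈S w∈ (min≢z ∘ sym) (max≢z ∘ sym)))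
            (proj₁ (IH∖ z∈S))
    ∣S∖max∖min∣ : length (S ∖ max ∖ min) ≡ k
    ∣S∖max∖min∣ = length-∖ (S ∖ max) (∖-unique max S!) min∈S∖max ∣S∖ max∈S ∣

  minLeaves-step : minLeaves S (suc n) ≡ g (suc n)
  minLeaves-step = begin
    minLeaves S (suc n)
      ≡⟨ ∑-arrangements-∷ʳ S n (λ w → 𝟙 (φ w ≟ 0)) ⟩
    ∑[ z ∈ S ] countAfter φ z
      ≡⟨ ∑-∖ S (countAfter φ) S! min∈S ⟩
    countAfter φ min + ∑[ z ∈ S ∖ min ] countAfter φ z
      ≡⟨ cong₂ _+_ atMin (∑-constOn (S ∖ min) other) ⟩
    ℓ n + length (S ∖ min) * g n
      ≡⟨ cong (λ a → ℓ n + a * g n) ∣S∖ min∈S ∣ ⟩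
    g (suc n)
      ∎
    where
    φ : List ℕ → ℕ
    φ w = firstChildren⁺ (beforeMin w)
    atMin : countAfter φ min ≡ ℓ n
    atMin = trans (countAfter-cong φ (λ w → children w 1)
                    (λ {w} w∈ → trans (cong firstChildren⁺ (beforeMin-append-min min∈S w∈ refl))
                                      (firstChildren⁺-nonempty w (arrangement-length (S ∖ min) n w∈))))
                  (proj₁ (IH∖ min∈S))
    other : ∀ {z} → z ∈ S ∖ min → countAfter φ z ≡ g n
    other z∈ with ∈-∖⁻ S z∈
    ... | z∈S , min≢z =
      trans (countAfter-cong φ φ (λ w∈ → cong firstChildren⁺ (beforeMin-append z∈S w∈ (min≢z ∘ sym))))
            (proj₁ (proj₂ (IH∖ z∈S)))

  maxLeaves-step : maxLeaves S (suc n) ≡ g (suc n)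
  maxLeaves-step = begin
    maxLeaves S (suc n)
      ≡⟨ ∑-arrangements-∷ʳ S n (λ w → 𝟙 (φ w ≟ 0)) ⟩
    ∑[ z ∈ S ] countAfter φ z
      ≡⟨ ∑-∖ S (countAfter φ) S! max∈S ⟩
    countAfter φ max + ∑[ z ∈ S ∖ max ] countAfter φ z
      ≡⟨ cong₂ _+_ atMax (∑-constOn (S ∖ max) other) ⟩
    ℓ n + length (S ∖ max) * g n
      ≡⟨ cong (λ a → ℓ n + a * g n) ∣S∖ max∈S ∣ ⟩
    g (suc n)
      ∎
    where
    φ : List ℕ → ℕ
    φ w = firstChildren⁺ (beforeMax w)
    atMax : countAfter φ max ≡ ℓ n
    atMax = trans (countAfter-cong φ (λ w → children w 1)
                    (λ {w} w∈ → trans (cong firstChildren⁺ (beforeMax-append-max max∈S w∈ refl))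
                                      (firstChildren⁺-nonempty w (arrangement-length (S ∖ max) n w∈))))
                  (proj₁ (IH∖ max∈S))
    other : ∀ {z} → z ∈ S ∖ max → countAfter φ z ≡ g n
    other z∈ with ∈-∖⁻ S z∈
    ... | z∈S , max≢z =
      trans (countAfter-cong φ φ (λ w∈ → cong firstChildren⁺ (beforeMax-append z∈S w∈ (max≢z ∘ sym))))
            (proj₂ (proj₂ (IH∖ z∈S)))

leafCounts-suc : ∀ k → LeafCounts (suc k) → LeafCounts (suc (suc k))
leafCounts-suc k IH S S! ∣S∣ = firstLeaves-step , minLeaves-step , maxLeaves-step
  where open LeafCountStep k IH S S! ∣S∣

leafCounts : ∀ k → LeafCounts (suc k)
leafCounts zero    = leafCounts-1
leafCounts (suc k) = leafCounts-suc k (leafCounts k)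

mutual
  ℓ≡g : ∀ k → ℓ (3 + k) ≡ g (3 + k)
  ℓ≡g zero    = refl
  ℓ≡g (suc k) = trans (ℓ-suc k) (sym (g-suc k))

  ℓ-suc : ∀ k → ℓ (4 + k) ≡ (4 + k) * ℓ (3 + k)
  ℓ-suc k = cong (λ x → x + (x + (2 + k) * ℓ (3 + k))) (sym (ℓ≡g k))

  g-suc : ∀ k → g (4 + k) ≡ (4 + k) * ℓ (3 + k)
  g-suc k = cong (λ x → ℓ (3 + k) + (3 + k) * x) (sym (ℓ≡g k))

3*ℓ≡! : ∀ k → 3 * ℓ (3 + k) ≡ (3 + k) !
3*ℓ≡! zero    = refl
3*ℓ≡! (suc k) = begin
  3 * ℓ (4 + k)                ≡⟨ cong (3 *_) (ℓ-suc k) ⟩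
  3 * ((4 + k) * ℓ (3 + k))    ≡⟨ x∙yz≈y∙xz 3 (4 + k) (ℓ (3 + k)) ⟩
  (4 + k) * (3 * ℓ (3 + k))    ≡⟨ cong ((4 + k) *_) (3*ℓ≡! k) ⟩
  (4 + k) !                    ∎
  where open ≡-Reasoning

-- Counting by the children of the i-th letter

at-∈ : ∀ l i → suc i ≤ length l → at l (suc i) ∈ l
at-∈ (y ∷ l) zero    _       = here refl
at-∈ (y ∷ l) (suc i) (s≤s i<) = there (at-∈ l i i<)

children-∷ : ∀ x w i → Unique (x ∷ w) → 2 ≤ i → i ≤ length w →
  children (x ∷ w) (suc i) ≡ children w i
children-∷ x (y ∷ l) (suc zero)    xw! (s≤s ()) _
children-∷ x (y ∷ l) (suc (suc i)) xw! _ (s≤s i≤) = childrenOf-prepend x y l xw! (at-∈ l i i≤)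

second-letter-indicators : ∀ w → Unique w → 2 ≤ length w →
  𝟙 (children w 2 ≟ 2) ≡ 𝟙 (children w 1 ≟ 0) ×
  𝟙 (children w 2 ≟ 0) ≡ 𝟙 (children (drop 1 w) 1 ≟ 0) ×
  children w 2 ≤ 2
second-letter-indicators (x ∷ [])    _ (s≤s ())
second-letter-indicators (x ∷ y ∷ l) xw!@(_ ∷ w!) _ with prepended x y l xw!
... | internal c₁≡1 c₂≡c =
  trans (𝟙-no (λ c₂≡2 → <⇒≢ (s≤s c≤1) (trans (sym c₂≡c) c₂≡2)))
        (sym (𝟙-no (λ c₁≡0 → 1+n≢0 (trans (sym c₁≡1) c₁≡0)))) ,
  cong (λ c → 𝟙 (c ≟ 0)) c₂≡c ,
  subst (_≤ 2) (sym c₂≡c) (m≤n⇒m≤1+n c≤1)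
  where
  c≤1 : children (y ∷ l) 1 ≤ 1
  c≤1 = children-first-≤1 (y ∷ l) w!
... | leafUnder c₁≡0 c≡1 c₂≡2 =
  trans (𝟙-yes c₂≡2) (sym (𝟙-yes c₁≡0)) ,
  trans (𝟙-no (λ c₂≡0 → 1+n≢0 (trans (sym c₂≡2) c₂≡0)))
        (sym (𝟙-no (λ c≡0 → 1+n≢0 (trans (sym c≡1) c≡0)))) ,
  subst (_≤ 2) (sym c₂≡2) ≤-refl

firstLeaves≡ℓ : ∀ S n → Unique S → length S ≡ suc n → firstLeaves S (suc n) ≡ ℓ (suc n)
firstLeaves≡ℓ S n S! ∣S∣ = proj₁ (leafCounts n S S! ∣S∣)

module SecondLetterCounts (k : ℕ) (S : List ℕ) (S! : Unique S) (∣S∣ : length S ≡ 4 + k) where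

  open ≡-Reasoning

  count : ℕ → ℕ
  count j = ∑[ w ∈ arrangements S (4 + k) ] 𝟙 (children w 2 ≟ j)

  private
    indicators : ∀ {w} → w ∈ arrangements S (4 + k) →
      𝟙 (children w 2 ≟ 2) ≡ 𝟙 (children w 1 ≟ 0) ×
      𝟙 (children w 2 ≟ 0) ≡ 𝟙 (children (drop 1 w) 1 ≟ 0) ×
      children w 2 ≤ 2
    indicators w∈ = second-letter-indicators _ (arrangement-unique S (4 + k) w∈)
                      (subst (2 ≤_) (sym (arrangement-length S (4 + k) w∈)) (s≤s (s≤s z≤n)))

  count-2 : count 2 ≡ ℓ (4 + k)
  count-2 = trans (∑-cong (arrangements S (4 + k)) (proj₁ ∘ indicators)) (firstLeaves≡ℓ S (3 + k) S! ∣S∣)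

  count-0 : count 0 ≡ ℓ (4 + k)
  count-0 = begin
    count 0
      ≡⟨ ∑-cong (arrangements S (4 + k)) (proj₁ ∘ proj₂ ∘ indicators) ⟩
    ∑[ w ∈ arrangements S (4 + k) ] 𝟙 (children (drop 1 w) 1 ≟ 0)
      ≡⟨ ∑-arrangements-∷ S (3 + k) (λ w → 𝟙 (children (drop 1 w) 1 ≟ 0)) ⟩
    ∑[ x ∈ S ] firstLeaves (S ∖ x) (3 + k)
      ≡⟨ ∑-constOn S (λ {x} x∈S → firstLeaves≡ℓ (S ∖ x) (2 + k) (∖-unique x S!)
                                      (length-∖ S S! x∈S ∣S∣)) ⟩
    length S * ℓ (3 + k)
      ≡⟨ trans (cong (_* ℓ (3 + k)) ∣S∣) (sym (ℓ-suc k)) ⟩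
    ℓ (4 + k)
      ∎

  count-total : count 0 + count 1 + count 2 ≡ (4 + k) !
  count-total = begin
    count 0 + count 1 + count 2
      ≡⟨ cong (_+ count 2) (sym (∑-+ (arrangements S (4 + k)) _ _)) ⟩
    ∑[ w ∈ arrangements S (4 + k) ] (𝟙 (children w 2 ≟ 0) + 𝟙 (children w 2 ≟ 1)) + count 2
      ≡⟨ sym (∑-+ (arrangements S (4 + k)) _ _) ⟩
    ∑[ w ∈ arrangements S (4 + k) ] (𝟙 (children w 2 ≟ 0) + 𝟙 (children w 2 ≟ 1) + 𝟙 (children w 2 ≟ 2))
      ≡⟨ ∑-cong (arrangements S (4 + k)) (λ w∈ → 𝟙-partition _ (proj₂ (proj₂ (indicators w∈)))) ⟩
    ∑[ w ∈ arrangements S (4 + k) ] 1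
      ≡⟨ ∑-arrangements-1 S (4 + k) S! ∣S∣ ⟩
    (4 + k) !
      ∎

  count-1 : count 1 ≡ ℓ (4 + k)
  count-1 = +-cancelˡ-≡ L (count 1) L (+-cancelʳ-≡ L (L + count 1) (L + L) (begin
    L + count 1 + L              ≡⟨ cong₂ (λ a b → a + count 1 + b) (sym count-0) (sym count-2) ⟩
    count 0 + count 1 + count 2  ≡⟨ count-total ⟩
    (4 + k) !                    ≡⟨ sym (3*ℓ≡! (suc k)) ⟩
    L + (L + (L + 0))            ≡⟨ cong (λ a → L + (L + a)) (+-identityʳ L) ⟩
    L + (L + L)                  ≡⟨ sym (+-assoc L L L) ⟩
    L + L + L                    ∎))
    where
    L : ℕ
    L = ℓ (4 + k)

count-children-at-2 : ∀ k S j → Unique S → length S ≡ 4 + k → j ≤ 2 →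
  ∑[ w ∈ arrangements S (4 + k) ] 𝟙 (children w 2 ≟ j) ≡ ℓ (4 + k)
count-children-at-2 k S 0 S! ∣S∣ _ = SecondLetterCounts.count-0 k S S! ∣S∣
count-children-at-2 k S 1 S! ∣S∣ _ = SecondLetterCounts.count-1 k S S! ∣S∣
count-children-at-2 k S 2 S! ∣S∣ _ = SecondLetterCounts.count-2 k S S! ∣S∣
count-children-at-2 k S (suc (suc (suc _))) _ _ (s≤s (s≤s ()))

count-children-at : ∀ i k S j → 2 ≤ i → i ≤ 2 + k → Unique S → length S ≡ 4 + k → j ≤ 2 →
  ∑[ w ∈ arrangements S (4 + k) ] 𝟙 (children w i ≟ j) ≡ ℓ (4 + k)
count-children-at 1 k S j (s≤s ()) _ _ _ _
count-children-at 2 k S j _ _ S! ∣S∣ j≤2 = count-children-at-2 k S j S! ∣S∣ j≤2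
count-children-at (suc (suc (suc i))) zero S j _ (s≤s (s≤s ())) _ _ _
count-children-at (suc (suc (suc i))) (suc k) S j _ (s≤s i≤) S! ∣S∣ j≤2 = begin
  ∑[ w ∈ arrangements S (5 + k) ] 𝟙 (children w (3 + i) ≟ j)
    ≡⟨ ∑-arrangements-∷ S (4 + k) _ ⟩
  ∑[ x ∈ S ] ∑[ w ∈ arrangements (S ∖ x) (4 + k) ] 𝟙 (children (x ∷ w) (3 + i) ≟ j)
    ≡⟨ ∑-constOn S inner ⟩
  length S * ℓ (4 + k)
    ≡⟨ trans (cong (_* ℓ (4 + k)) ∣S∣) (sym (ℓ-suc (suc k))) ⟩
  ℓ (5 + k)
    ∎
  where
  open ≡-Reasoning
  inner : ∀ {x} → x ∈ S →
    ∑[ w ∈ arrangements (S ∖ x) (4 + k) ] 𝟙 (children (x ∷ w) (3 + i) ≟ j) ≡ ℓ (4 + k)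
  inner {x} x∈S = trans
    (∑-cong (arrangements (S ∖ x) (4 + k)) (λ {w} w∈ → cong (λ c → 𝟙 (c ≟ j))
      (children-∷ x w (2 + i) (arrangement-unique-∷ S x (4 + k) w∈) (s≤s (s≤s z≤n))
        (subst (2 + i ≤_) (sym (arrangement-length (S ∖ x) (4 + k) w∈)) (≤-trans i≤ (m≤n+m _ 2))))))
    (count-children-at (2 + i) k (S ∖ x) j (s≤s (s≤s z≤n)) i≤ (∖-unique x S!) (length-∖ S S! x∈S ∣S∣)
                       j≤2)

ℓ≡!/3 : ∀ k → ℓ (3 + k) ≡ (3 + k) ! / 3
ℓ≡!/3 k = sym (trans (cong (_/ 3) (trans (sym (3*ℓ≡! k)) (*-comm 3 (ℓ (3 + k))))) (m*n/n≡m (ℓ (3 + k)) 3))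

mainTheorem3 : ∀ (n : ℕ) → 4 ≤ n → ∀ (i : ℕ) → 2 ≤ i → i ≤ n ∸ 2 →
    ∀ (j : ℕ) → j ≤ 2 → d n i j ≡ (n !) / 3
mainTheorem3 .(4 + k) (s≤s (s≤s (s≤s (s≤s (z≤n {k}))))) i 2≤i i≤n∸2 j j≤2 = begin
  d n i j
    ≡⟨ d≡∑-arrangements n i j ⟩
  ∑[ w ∈ arrangements letters n ] 𝟙 (children w i ≟ j)
    ≡⟨ count-children-at i k letters j 2≤i i≤n∸2 letters-unique letters-length j≤2 ⟩
  ℓ n
    ≡⟨ ℓ≡!/3 (suc k) ⟩
  n ! / 3
    ∎
  where
  open ≡-Reasoning
  n : ℕ
  n = 4 + k
  letters : List ℕ
  letters = map suc (upTo n)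
  letters-unique : Unique letters
  letters-unique = map⁺ suc-injective (upTo⁺ n)
  letters-length : length letters ≡ n
  letters-length = trans (length-map suc (upTo n)) (length-upTo n)
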